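{- If $\Gamma;\Omega;\Delta\vdash M:A\to^kB$ and $x$ is a variable not declared in $\Gamma,\Omega,\Delta$ (hence not free in $M$), then $\Gamma;\Omega;\Delta\vdash\lambda x^k{:}A.\,M\,x^k:A\to^kB$.
   Context: Strict $\lambda$-calculus over a signature $\Sigma$. Labels $k\in\{1,0,u\}$; types $A::=a\mid A_1\to^kA_2$; terms $c\mid x\mid\lambda x^k{:}A.M\mid M_1M_2^k$. $\eta$-expansion at type $A\to^kB$: $M\to\lambda x^k{:}A.\,M\,x^k$. Contexts: finite sets of declarations with distinct variables; commas denote disjoint union. Typing $\Gamma;\Omega;\Delta\vdash M:A$ (unrestricted, irrelevant, strict; disjoint): if $c{:}A\in\Sigma$ then $\Gamma;\Omega;\cdot\vdash c:A$; $(\Gamma,x{:}A);\Omega;\cdot\vdash x:A$; $\Gamma;\Omega;x{:}A\vdash x:A$ (no rule for $\Omega$); from $(\Gamma,x{:}A);\Omega;\Delta\vdash M:B$ infer $\Gamma;\Omega;\Delta\vdash\lambda x^u{:}A.M:A\to^uB$; from $\Gamma;(\Omega,x{:}A);\Delta\vdash M:B$ infer $\Gamma;\Omega;\Delta\vdash\lambda x^0{:}A.M:A\to^0B$; from $\Gamma;\Omega;(\Delta,x{:}A)\vdash M:B$ infer $\Gamma;\Omega;\Delta\vdash\lambda x^1{:}A.M:A\to^1B$; from $\Gamma;\Omega;\Delta\vdash M:A\to^uB$ and $(\Gamma,\Delta);\Omega;\cdot\vdash N:A$ infer $\Gamma;\Omega;\Delta\vdash MN^u:B$; from $\Gamma;\Omega;\Delta\vdash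 M:A\to^0B$ and $(\Gamma,\Omega,\Delta);\cdot;\cdot\vdash N:A$ infer $\Gamma;\Omega;\Delta\vdash MN^0:B$; from $(\Gamma,\Delta_N);\Omega;\Delta_M\vdash M:A\to^1B$ and $(\Gamma,\Delta_M);\Omega;\Delta_N\vdash N:A$ infer $\Gamma;\Omega;(\Delta_M,\Delta_N)\vdash MN^1:B$. -}

module Defs where

open import Data.Nat using (ℕ; zero; suc; _<ᵇ_)
open import Data.Bool using (if_then_else_)
open import Data.Product using (_×_; _,_)
open import Data.List using (List; []; _∷_)
open import Data.List.Membership.Propositional using (_∈_)
open import Relation.Binary.PropositionalEquality using (_≢_)

data Label : Set where
  one  : Label
  zer  : Label
  unr  : Label

data Ty : Set where
  base  : ℕ → Ty
  _⇒[_]_ : Ty → Label → Ty → Ty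

-- Terms  c | x | λx^k:A.M | M₁ M₂^k   (variables as de Bruijn indices,
-- i.e. terms up to α-equivalence; constants named by ℕ)
data Tm : Set where
  const : ℕ → Tm
  var   : ℕ → Tm
  lam   : Label → Ty → Tm → Tm
  app   : Tm → Label → Tm → Tm

Sig : Set
Sig = List (ℕ × Ty)

-- A combined context: each declaration is tagged with the zone it lives in:
--   unr = Γ (unrestricted), zer = Ω (irrelevant), one = Δ (strict).
-- Position i (de Bruijn index i) is the i-th most recently bound variable.
-- Distinctness of variables / disjointness of Γ, Ω, Δ is automatic.
Ctx : Set
Ctx = List (Label × Ty)

data NoStrict : Ctx → Set where
  []  : NoStrict []
  _∷_ : ∀ {k A Γ} → k ≢ one → NoStrict Γ → NoStrict ((k , A) ∷ Γ)

data _∋_∶_at_ : Ctx → ℕ → Ty → Label → Set where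
  here  : ∀ {Γ k A} → ((k , A) ∷ Γ) ∋ zero ∶ A at k
  there : ∀ {Γ k A e i} → Γ ∋ i ∶ A at k → (e ∷ Γ) ∋ suc i ∶ A at k

data _∋_∶_only-strict : Ctx → ℕ → Ty → Set where
  here  : ∀ {Γ A} → NoStrict Γ → ((one , A) ∷ Γ) ∋ zero ∶ A only-strict
  there : ∀ {Γ k B A i} → k ≢ one → Γ ∋ i ∶ A only-strict →
          ((k , B) ∷ Γ) ∋ suc i ∶ A only-strict

promote : Ctx → Ctx
promote [] = []
promote ((one , A) ∷ Γ) = (unr , A) ∷ promote Γ
promote ((k , A) ∷ Γ) = (k , A) ∷ promote Γ

allUnr : Ctx → Ctx
allUnr [] = []
allUnr ((k , A) ∷ Γ) = (unr , A) ∷ allUnr Γ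

-- Split Γ;Ω;(Δ_M,Δ_N) into (Γ,Δ_N);Ω;Δ_M (left) and (Γ,Δ_M);Ω;Δ_N (right)
data Split : Ctx → Ctx → Ctx → Set where
  []    : Split [] [] []
  keep  : ∀ {Γ L R k A} → k ≢ one → Split Γ L R →
          Split ((k , A) ∷ Γ) ((k , A) ∷ L) ((k , A) ∷ R)
  left  : ∀ {Γ L R A} → Split Γ L R →
          Split ((one , A) ∷ Γ) ((one , A) ∷ L) ((unr , A) ∷ R)
  right : ∀ {Γ L R A} → Split Γ L R →
          Split ((one , A) ∷ Γ) ((unr , A) ∷ L) ((one , A) ∷ R)

data _∣_⊢_∶_ (Σ : Sig) : Ctx → Tm → Ty → Set where
  ⊢const : ∀ {Γ c A} → (c , A) ∈ Σ → NoStrict Γ → Σ ∣ Γ ⊢ const c ∶ A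
  ⊢varu  : ∀ {Γ i A} → Γ ∋ i ∶ A at unr → NoStrict Γ → Σ ∣ Γ ⊢ var i ∶ A
  ⊢var1  : ∀ {Γ i A} → Γ ∋ i ∶ A only-strict → Σ ∣ Γ ⊢ var i ∶ A
  ⊢lam   : ∀ {Γ k A B M} → Σ ∣ ((k , A) ∷ Γ) ⊢ M ∶ B → Σ ∣ Γ ⊢ lam k A M ∶ (A ⇒[ k ] B)
  ⊢appu  : ∀ {Γ A B M N} → Σ ∣ Γ ⊢ M ∶ (A ⇒[ unr ] B) → Σ ∣ promote Γ ⊢ N ∶ A →
           Σ ∣ Γ ⊢ app M unr N ∶ B
  ⊢app0  : ∀ {Γ A B M N} → Σ ∣ Γ ⊢ M ∶ (A ⇒[ zer ] B) → Σ ∣ allUnr Γ ⊢ N ∶ A →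
           Σ ∣ Γ ⊢ app M zer N ∶ B
  ⊢app1  : ∀ {Γ L R A B M N} → Split Γ L R → Σ ∣ L ⊢ M ∶ (A ⇒[ one ] B) →
           Σ ∣ R ⊢ N ∶ A → Σ ∣ Γ ⊢ app M one N ∶ B

-- Weakening shift: increase every variable index ≥ c by one
-- (de Bruijn rendering of 'x is a fresh variable, not free in M')
shift : ℕ → Tm → Tm
shift c (const a) = const a
shift c (var i) = if i <ᵇ c then var i else var (suc i)
shift c (lam k A M) = lam k A (shift (suc c) M)
shift c (app M k N) = app (shift c M) k (shift c N)

η-expand : Label → Ty → Tm → Tm
η-expand k A M = lam k A (app (shift zero M) k (var zero))

{-# OPTIONS --safe #-}
module Submission where

open import Defs
open import Data.Nat using (ℕ; zero; suc; _<ᵇ_)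
open import Data.Bool.Properties using (if-float)
open import Data.List using ([]; _∷_)
open import Data.Product using (_×_; _,_; ∃₂)
open import Relation.Binary.PropositionalEquality using (_≡_; refl; _≢_; sym; trans; cong)

-- The η-expansion is typed by the application rule of its label.  The argument x is
-- typed in the context the rule prescribes for it; in the strict case the split gives
-- x alone to the argument and all of Δ to M.  The only real work is that M stays
-- typable after a fresh unrestricted or irrelevant declaration is added to its context;
-- a strict declaration could not be added, since it would have to be used.

data Insert : ℕ → Ctx → Ctx → Set where
  here  : ∀ {Γ k A} → k ≢ one → Insert zero Γ ((k , A) ∷ Γ)
  there : ∀ {c e Γ Γ'} → Insert c Γ Γ' → Insert (suc c) (e ∷ Γ) (e ∷ Γ')

shiftVar : ℕ → ℕ → ℕ
shiftVar zero    i       = suc i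
shiftVar (suc c) zero    = zero
shiftVar (suc c) (suc i) = suc (shiftVar c i)

shift-var : ∀ c i → shift c (var i) ≡ var (shiftVar c i)
shift-var zero    i       = refl
shift-var (suc c) zero    = refl
shift-var (suc c) (suc i) =
  trans (sym (if-float (shift zero) (i <ᵇ c))) (cong (shift zero) (shift-var c i))

Insert-NoStrict : ∀ {c Γ Γ'} → Insert c Γ Γ' → NoStrict Γ → NoStrict Γ'
Insert-NoStrict (here k≢one) ns       = k≢one ∷ ns
Insert-NoStrict (there ι)    (p ∷ ns) = p ∷ Insert-NoStrict ι ns

Insert-∋ : ∀ {c Γ Γ' i A k} → Insert c Γ Γ' → Γ ∋ i ∶ A at k → Γ' ∋ shiftVar c i ∶ A at k
Insert-∋ (here _)  x         = there x
Insert-∋ (there ι) here      = here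
Insert-∋ (there ι) (there x) = there (Insert-∋ ι x)

Insert-only-strict : ∀ {c Γ Γ' i A} → Insert c Γ Γ' →
  Γ ∋ i ∶ A only-strict → Γ' ∋ shiftVar c i ∶ A only-strict
Insert-only-strict (here k≢one) x           = there k≢one x
Insert-only-strict (there ι)    (here ns)   = here (Insert-NoStrict ι ns)
Insert-only-strict (there ι)    (there p x) = there p (Insert-only-strict ι x)

Insert-promote : ∀ {c Γ Γ'} → Insert c Γ Γ' → Insert c (promote Γ) (promote Γ')
Insert-promote (here {k = one} k≢one) with () ← k≢one refl
Insert-promote (here {k = zer} k≢one) = here k≢one
Insert-promote (here {k = unr} k≢one) = here k≢one
Insert-promote (there {e = one , _} ι) = there (Insert-promote ι)
Insert-promote (there {e = zer , _} ι) = there (Insert-promote ι)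
Insert-promote (there {e = unr , _} ι) = there (Insert-promote ι)

Insert-allUnr : ∀ {c Γ Γ'} → Insert c Γ Γ' → Insert c (allUnr Γ) (allUnr Γ')
Insert-allUnr (here _)  = here λ ()
Insert-allUnr (there ι) = there (Insert-allUnr ι)

Insert-Split : ∀ {c Γ Γ' L R} → Insert c Γ Γ' → Split Γ L R →
  ∃₂ λ L' R' → Split Γ' L' R' × Insert c L L' × Insert c R R'
Insert-Split (here k≢one) s = _ , _ , keep k≢one s , here k≢one , here k≢one
Insert-Split (there ι) (keep p s) with _ , _ , s' , ιL , ιR ← Insert-Split ι s =
  _ , _ , keep p s' , there ιL , there ιR
Insert-Split (there ι) (left s)   with _ , _ , s' , ιL , ιR ← Insert-Split ι s =
  _ , _ , left s' , there ιL , there ιR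
Insert-Split (there ι) (right s)  with _ , _ , s' , ιL , ιR ← Insert-Split ι s =
  _ , _ , right s' , there ιL , there ιR

weaken : ∀ {Σ c Γ Γ' M T} → Insert c Γ Γ' → Σ ∣ Γ ⊢ M ∶ T → Σ ∣ Γ' ⊢ shift c M ∶ T
weaken ι (⊢const c∈Σ ns) = ⊢const c∈Σ (Insert-NoStrict ι ns)
weaken {c = c} ι (⊢varu {i = i} x ns) rewrite shift-var c i =
  ⊢varu (Insert-∋ ι x) (Insert-NoStrict ι ns)
weaken {c = c} ι (⊢var1 {i = i} x) rewrite shift-var c i = ⊢var1 (Insert-only-strict ι x)
weaken ι (⊢lam ⊢M)       = ⊢lam (weaken (there ι) ⊢M)
weaken ι (⊢appu ⊢M ⊢N)   = ⊢appu (weaken ι ⊢M) (weaken (Insert-promote ι) ⊢N)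
weaken ι (⊢app0 ⊢M ⊢N)   = ⊢app0 (weaken ι ⊢M) (weaken (Insert-allUnr ι) ⊢N)
weaken ι (⊢app1 s ⊢M ⊢N) with _ , _ , s' , ιL , ιR ← Insert-Split ι s =
  ⊢app1 s' (weaken ιL ⊢M) (weaken ιR ⊢N)

weaken-fresh : ∀ {Σ Γ M T k A} → k ≢ one → Σ ∣ Γ ⊢ M ∶ T → Σ ∣ (k , A) ∷ Γ ⊢ shift zero M ∶ T
weaken-fresh k≢one = weaken (here k≢one)

NoStrict-promote : ∀ Γ → NoStrict (promote Γ)
NoStrict-promote []              = []
NoStrict-promote ((one , _) ∷ Γ) = (λ ()) ∷ NoStrict-promote Γ
NoStrict-promote ((zer , _) ∷ Γ) = (λ ()) ∷ NoStrict-promote Γ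
NoStrict-promote ((unr , _) ∷ Γ) = (λ ()) ∷ NoStrict-promote Γ

NoStrict-allUnr : ∀ Γ → NoStrict (allUnr Γ)
NoStrict-allUnr []      = []
NoStrict-allUnr (_ ∷ Γ) = (λ ()) ∷ NoStrict-allUnr Γ

Split-allLeft : ∀ Γ → Split Γ Γ (promote Γ)
Split-allLeft []              = []
Split-allLeft ((one , _) ∷ Γ) = left (Split-allLeft Γ)
Split-allLeft ((zer , _) ∷ Γ) = keep (λ ()) (Split-allLeft Γ)
Split-allLeft ((unr , _) ∷ Γ) = keep (λ ()) (Split-allLeft Γ)

theorem3p6 : (Σ : Sig) (Γ : Ctx) (M : Tm) (A B : Ty) (k : Label) →
    Σ ∣ Γ ⊢ M ∶ (A ⇒[ k ] B) →
    Σ ∣ Γ ⊢ lam k A (app (shift zero M) k (var zero)) ∶ (A ⇒[ k ] B)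
theorem3p6 Σ Γ M A B unr ⊢M =
  ⊢lam (⊢appu (weaken-fresh (λ ()) ⊢M) (⊢varu here ((λ ()) ∷ NoStrict-promote Γ)))
theorem3p6 Σ Γ M A B zer ⊢M =
  ⊢lam (⊢app0 (weaken-fresh (λ ()) ⊢M) (⊢varu here ((λ ()) ∷ NoStrict-allUnr Γ)))
theorem3p6 Σ Γ M A B one ⊢M =
  ⊢lam (⊢app1 (right (Split-allLeft Γ)) (weaken-fresh (λ ()) ⊢M) (⊢var1 (here (NoStrict-promote Γ))))
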